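{- The iterative fixed point beginning with $a$ of the morphism $a\to aca$, $b\to bc$, $c\to b$ is not $d$-automatic for any $d\ge 2$. The iterative fixed point beginning with $a$ of the morphism $a\to aca$, $c\to cd$, $d\to c$ is not $d$-automatic for any $d\ge 2$.
   Context: An iterative fixed point of a morphism $\sigma$ beginning with $a$ is $\lim_n\sigma^n(a)$ (here $\sigma(a)$ begins with $a$). A sequence is $d$-automatic if it is the image under a letter-to-letter map of a fixed point of a morphism all of whose images have length $d$. -}

module Defs where

open import Data.Nat using (ℕ; zero; suc; _≤_)
open import Data.Fin using (Fin; toℕ)
open import Data.List using (List; []; _∷_; length; lookup; concatMap)
open import Data.Product using (Σ; ∃; _×_; _,_)
open import Relation.Binary.PropositionalEquality using (_≡_)

Morphism : Set → Set
Morphism A = A → List A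

applyM : {A : Set} → Morphism A → List A → List A
applyM σ w = concatMap σ w

iterM : {A : Set} → Morphism A → ℕ → A → List A
iterM σ zero    s = s ∷ []
iterM σ (suc n) s = applyM σ (iterM σ n s)

IsPrefix : {A : Set} → List A → (ℕ → A) → Set
IsPrefix u x = (i : Fin (length u)) → lookup u i ≡ x (toℕ i)

-- x is the iterative fixed point lim_n σ^n(a) of σ beginning with a:
-- σ(a) begins with a, every σ^n(a) is a prefix of x, and the
-- lengths |σ^n(a)| are unbounded (so the limit is an infinite word).
IsIterativeFixedPoint : {A : Set} → Morphism A → A → (ℕ → A) → Set
IsIterativeFixedPoint {A} σ s x =
  (Σ (List A) λ u → σ s ≡ s ∷ u)
  × ((n : ℕ) → IsPrefix (iterM σ n s) x)
  × ((m : ℕ) → ∃ λ n → m ≤ length (iterM σ n s))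

Uniform : {B : Set} → ℕ → Morphism B → Set
Uniform {B} d τ = (b : B) → length (τ b) ≡ d

Automatic : {A : Set} → ℕ → (ℕ → A) → Set
Automatic {A} d x =
  Σ ℕ λ k → Σ (Morphism (Fin k)) λ τ → Σ (Fin k) λ s →
  Σ (ℕ → Fin k) λ y → Σ (Fin k → A) λ f →
    Uniform d τ × IsIterativeFixedPoint τ s y × ((n : ℕ) → x n ≡ f (y n))

data ABC : Set where
  a b c : ABC

σ₁ : Morphism ABC
σ₁ a = a ∷ c ∷ a ∷ []
σ₁ b = b ∷ c ∷ []
σ₁ c = b ∷ []

data ACD : Set where
  a c d : ACD

σ₂ : Morphism ACD
σ₂ a = a ∷ c ∷ a ∷ []
σ₂ c = c ∷ d ∷ []
σ₂ d = c ∷ []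

-- For every n both fixed points contain two occurrences of a separated by exactly fib (2 + n)
-- other letters: σ^(m+1)(a) = σ^m(a) σ^m(c) σ^m(a), where σ^m(a) begins and ends with a and
-- σ^m(c) has Fibonacci length and contains no a.
--
-- If x were d-automatic, generated by a fixed point y over K letters, then for L = d^k the
-- letters of x in the block [q L, q L + L) are determined by y q. Two gaps of length at least L
-- whose first and last blocks carry the same pair of y-values therefore start and end at the
-- same residues mod L, so their lengths are congruent mod L. Among K² + 1 gaps two carry the
-- same pair. On the other hand the Fibonacci sequence is purely periodic mod L, which yields
-- K² + 1 gap lengths at least L that are pairwise incongruent mod L as soon as fib (K² + 3) < L,
-- e.g. for k = fib (K² + 3).

module Submission where

open import Defs
open import Data.Nat using (ℕ; _≤_)
open import Data.Product using (_×_)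
open import Relation.Nullary using (¬_)

open import Data.Nat using (zero; suc; _+_; _*_; _∸_; _^_; _<_; z≤n; s≤s; s≤s⁻¹; NonZero; >-nonZero)
open import Data.Nat.Properties
open import Data.Nat.DivMod using (_/_; _%_; m≡m%n+[m/n]*n; m%n<n; m%n≤n; m/n*n≤m; [m+kn]%n≡m%n; m<n⇒m%n≡m)
open import Data.Nat.Tactic.RingSolver using (solve-∀)
open import Data.Fin as Fin using (Fin; toℕ; combine)
import Data.Fin.Properties as Finₚ
open import Data.List using (List; []; _∷_; _++_; length; concatMap; map)
open import Data.Nat.ListAction using (sum)
open import Data.List.Properties using (concatMap-++; concatMap-pure; ++-assoc; ++-identityʳ; length-++)
open import Data.List.Relation.Unary.All as All using (All; []; _∷_)
open import Data.List.Relation.Unary.All.Properties using (concat⁺; map⁺)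
open import Data.Product using (Σ; ∃; ∃₂; _,_; proj₁; proj₂)
open import Data.Empty using (⊥-elim)
open import Data.Sum using (inj₁; inj₂)
open import Relation.Binary.Definitions using (tri<; tri≈; tri>)
open import Relation.Binary.PropositionalEquality

module _ {A : Set} where

  prefix-head : ∀ {t w} (z : ℕ → A) → IsPrefix (t ∷ w) z → z 0 ≡ t
  prefix-head z P = sym (P Fin.zero)

  prefix-tail : ∀ {t w} (z : ℕ → A) → IsPrefix (t ∷ w) z → IsPrefix w (λ i → z (suc i))
  prefix-tail z P i = P (Fin.suc i)

  prefix-cons : ∀ {t w} (z : ℕ → A) → z 0 ≡ t → IsPrefix w (λ i → z (suc i)) → IsPrefix (t ∷ w) z
  prefix-cons z z₀≡t P Fin.zero    = sym z₀≡t
  prefix-cons z z₀≡t P (Fin.suc i) = P i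

  prefix-resp : ∀ u {z z' : ℕ → A} → (∀ i → z i ≡ z' i) → IsPrefix u z → IsPrefix u z'
  prefix-resp u z≗z' P i = trans (P i) (z≗z' (toℕ i))

  prefix-unique : ∀ {u} (z z' : ℕ → A) → IsPrefix u z → IsPrefix u z' → ∀ {i} → i < length u → z i ≡ z' i
  prefix-unique {_ ∷ _} z z' P P' {zero}  _         = trans (prefix-head z P) (sym (prefix-head z' P'))
  prefix-unique {_ ∷ u} z z' P P' {suc i} (s≤s i<n) =
    prefix-unique {u} (λ i → z (suc i)) (λ i → z' (suc i)) (prefix-tail z P) (prefix-tail z' P') i<n

  prefix-All : ∀ {P : A → Set} {u} (z : ℕ → A) → IsPrefix u z → All P u → ∀ {i} → i < length u → P (z i)
  prefix-All z pre (pt ∷ _)  {zero}  _         = subst _ (sym (prefix-head z pre)) pt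
  prefix-All z pre (_ ∷ pu)  {suc i} (s≤s i<n) = prefix-All (λ i → z (suc i)) (prefix-tail z pre) pu i<n

  prefix-++ˡ : ∀ u {v} (z : ℕ → A) → IsPrefix (u ++ v) z → IsPrefix u z
  prefix-++ˡ []      z P ()
  prefix-++ˡ (_ ∷ u) z P =
    prefix-cons z (prefix-head z P) (prefix-++ˡ u (λ i → z (suc i)) (prefix-tail z P))

  prefix-++ʳ : ∀ u {v} (z : ℕ → A) → IsPrefix (u ++ v) z → IsPrefix v (λ i → z (length u + i))
  prefix-++ʳ []      z P = P
  prefix-++ʳ (_ ∷ u) z P = prefix-++ʳ u (λ i → z (suc i)) (prefix-tail z P)

  prefix-++⁺ : ∀ u {v} (z : ℕ → A) → IsPrefix u z → IsPrefix v (λ i → z (length u + i)) → IsPrefix (u ++ v) z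
  prefix-++⁺ []      z P Q = Q
  prefix-++⁺ (_ ∷ u) z P Q =
    prefix-cons z (prefix-head z P) (prefix-++⁺ u (λ i → z (suc i)) (prefix-tail z P) Q)

module _ {A : Set} (σ : Morphism A) where

  applyM-concatMap : ∀ (g : A → List A) w → applyM σ (concatMap g w) ≡ concatMap (λ t → applyM σ (g t)) w
  applyM-concatMap g []      = refl
  applyM-concatMap g (t ∷ w) =
    trans (concatMap-++ σ (g t) (concatMap g w)) (cong (applyM σ (g t) ++_) (applyM-concatMap g w))

  iterM-suc : ∀ m t → iterM σ (suc m) t ≡ concatMap (iterM σ m) (σ t)
  iterM-suc zero    t = trans (++-identityʳ (σ t)) (sym (concatMap-pure (σ t)))
  iterM-suc (suc m) t = trans (cong (applyM σ) (iterM-suc m t)) (applyM-concatMap (iterM σ m) (σ t))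

  length-iterM-suc : ∀ m t → length (iterM σ (suc m) t) ≡ sum (map (λ u → length (iterM σ m u)) (σ t))
  length-iterM-suc m t = trans (cong length (iterM-suc m t)) (length-concatMap (σ t))
    where
    length-concatMap : ∀ w → length (concatMap (iterM σ m) w) ≡ sum (map (λ u → length (iterM σ m u)) w)
    length-concatMap []      = refl
    length-concatMap (u ∷ w) =
      trans (length-++ (iterM σ m u)) (cong (length (iterM σ m u) +_) (length-concatMap w))

  iterM-All : ∀ {P : A → Set} → (∀ {t} → P t → All P (σ t)) → ∀ m {t} → P t → All P (iterM σ m t)
  iterM-All σ-pres zero    pt = pt ∷ []
  iterM-All σ-pres (suc m) pt = concat⁺ (map⁺ (All.map σ-pres (iterM-All σ-pres m pt)))

Gap : {A : Set} → A → (ℕ → A) → ℕ → Set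
Gap s z G = z 0 ≡ s × (∀ i → i < G → z (suc i) ≢ s) × z (suc G) ≡ s

GapAt : {A : Set} → A → (ℕ → A) → ℕ → ℕ → Set
GapAt s x p G = Gap s (λ i → x (p + i)) G

gap-of-prefix : ∀ {A : Set} {s : A} C {w} (z : ℕ → A) → IsPrefix (s ∷ C ++ s ∷ w) z → All (_≢ s) C →
                Gap s z (length C)
gap-of-prefix C z P C-avoids =
  prefix-head z P ,
  (λ i i<n → prefix-All (λ i → z (suc i)) (prefix-++ˡ C (λ i → z (suc i)) (prefix-tail z P)) C-avoids i<n) ,
  trans (cong (λ i → z (suc i)) (sym (+-identityʳ (length C))))
        (prefix-head (λ i → z (suc (length C + i))) (prefix-++ʳ C (λ i → z (suc i)) (prefix-tail z P)))

module _ {A : Set} {s : A} (x : ℕ → A) where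

  gap-start : ∀ p G → GapAt s x p G → x p ≡ s
  gap-start p G (start , _ , _) = trans (cong x (sym (+-identityʳ p))) start

  gap-interior : ∀ p G → GapAt s x p G → ∀ {m} → p < m → m ≤ p + G → x m ≢ s
  gap-interior p G (_ , avoids , _) {m} p<m m≤p+G =
    subst (λ k → x k ≢ s) p+[1+i]≡m (avoids i i<G)
    where
    i = m ∸ suc p
    p+[1+i]≡m : p + suc i ≡ m
    p+[1+i]≡m = trans (+-suc p i) (m+[n∸m]≡n p<m)
    i<G : i < G
    i<G = subst (i <_) (m+n∸m≡n (suc p) G) (∸-monoˡ-< (s≤s m≤p+G) p<m)

module _ {A : Set} (σ : Morphism A) {s t : A} (σs≡sts : σ s ≡ s ∷ t ∷ s ∷ []) where

  iterM-split : ∀ m → iterM σ (suc m) s ≡ iterM σ m s ++ iterM σ m t ++ iterM σ m s ++ []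
  iterM-split m = trans (iterM-suc σ m s) (cong (concatMap (iterM σ m)) σs≡sts)

  iterM-head : ∀ m → ∃ λ w → iterM σ m s ≡ s ∷ w
  iterM-head zero    = [] , refl
  iterM-head (suc m) with w , eq ← iterM-head m =
    _ , trans (iterM-split m) (cong (_++ iterM σ m t ++ iterM σ m s ++ []) eq)

  iterM-last : ∀ m → ∃ λ u → iterM σ m s ≡ u ++ s ∷ []
  iterM-last zero    = [] , refl
  iterM-last (suc m) with u , eq ← iterM-last m = iterM σ m s ++ iterM σ m t ++ u , (begin
    iterM σ (suc m) s                               ≡⟨ iterM-split m ⟩
    S ++ T ++ iterM σ m s ++ []                     ≡⟨ cong (λ v → S ++ T ++ v) (trans (++-identityʳ _) eq) ⟩
    S ++ T ++ u ++ s ∷ []                           ≡⟨ cong (S ++_) (sym (++-assoc T u _)) ⟩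
    S ++ (T ++ u) ++ s ∷ []                         ≡⟨ sym (++-assoc S (T ++ u) _) ⟩
    (S ++ T ++ u) ++ s ∷ []                         ∎)
    where
    open ≡-Reasoning
    S = iterM σ m s
    T = iterM σ m t

  gap-iterM : ∀ (x : ℕ → A) → (∀ n → IsPrefix (iterM σ n s) x) →
              ∀ m → All (_≢ s) (iterM σ m t) → ∃ λ p → GapAt s x p (length (iterM σ m t))
  gap-iterM x P m T-avoids with u , eu ← iterM-last m | w , ew ← iterM-head m =
    length u ,
    gap-of-prefix T (λ i → x (length u + i))
      (prefix-++ʳ u x (subst (λ v → IsPrefix v x) split (P (suc m)))) T-avoids
    where
    T = iterM σ m t
    split : iterM σ (suc m) s ≡ u ++ s ∷ T ++ s ∷ w ++ []
    split = trans (iterM-split m)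
      (trans (cong₂ (λ v v' → v ++ T ++ v' ++ []) eu ew) (++-assoc u (s ∷ []) _))

fib : ℕ → ℕ
fib 0             = 0
fib 1             = 1
fib (suc (suc n)) = fib (suc n) + fib n

fib-suc-pos : ∀ n → 1 ≤ fib (suc n)
fib-suc-pos zero    = ≤-refl
fib-suc-pos (suc n) = ≤-trans (fib-suc-pos n) (m≤m+n (fib (suc n)) (fib n))

fib-<-suc : ∀ n → fib (2 + n) < fib (3 + n)
fib-<-suc n = m<m+n (fib (2 + n)) (fib-suc-pos n)

fib-strictMono : ∀ {m n} → m < n → fib (2 + m) < fib (2 + n)
fib-strictMono {m} {suc n} (s≤s m≤n) with m≤n⇒m<n∨m≡n m≤n
... | inj₁ m<n  = <-trans (fib-strictMono m<n) (fib-<-suc n)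
... | inj₂ refl = fib-<-suc m

fib-injective : ∀ {m n} → fib (2 + m) ≡ fib (2 + n) → m ≡ n
fib-injective {m} {n} eq with <-cmp m n
... | tri< m<n _ _ = ⊥-elim (<⇒≢ (fib-strictMono m<n) eq)
... | tri≈ _ m≡n _ = m≡n
... | tri> _ _ n<m = ⊥-elim (<⇒≢ (fib-strictMono n<m) (sym eq))

n<fib[2+n] : ∀ n → n < fib (2 + n)
n<fib[2+n] zero    = ≤-refl
n<fib[2+n] (suc n) = <-≤-trans (s≤s (n<fib[2+n] n)) (fib-<-suc n)

-- Congruence stated without subtraction, so that every manipulation is a semiring identity.
infix 4 _≡_mod_

_≡_mod_ : ℕ → ℕ → ℕ → Set
u ≡ v mod L = ∃₂ λ α β → u + α * L ≡ v + β * L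

module _ {L : ℕ} where

  mod-refl : ∀ {u} → u ≡ u mod L
  mod-refl = 0 , 0 , refl

  mod-sym : ∀ {u v} → u ≡ v mod L → v ≡ u mod L
  mod-sym (α , β , eq) = β , α , sym eq

  mod-trans : ∀ {u v w} → u ≡ v mod L → v ≡ w mod L → u ≡ w mod L
  mod-trans {u} {v} {w} (α , β , e₁) (γ , δ , e₂) = α + γ , δ + β , (begin
    u + (α + γ) * L     ≡⟨ shift u α γ L ⟩
    (u + α * L) + γ * L ≡⟨ cong (_+ γ * L) e₁ ⟩
    (v + β * L) + γ * L ≡⟨ swap v β γ L ⟩
    (v + γ * L) + β * L ≡⟨ cong (_+ β * L) e₂ ⟩
    (w + δ * L) + β * L ≡⟨ shift w δ β L ⟨
    w + (δ + β) * L     ∎)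
    where
    open ≡-Reasoning
    shift : ∀ u α γ L → u + (α + γ) * L ≡ (u + α * L) + γ * L
    shift = solve-∀
    swap : ∀ v β γ L → (v + β * L) + γ * L ≡ (v + γ * L) + β * L
    swap = solve-∀

  mod-+ : ∀ {u v u' v'} → u ≡ v mod L → u' ≡ v' mod L → u + u' ≡ v + v' mod L
  mod-+ {u} {v} {u'} {v'} (α , β , e₁) (γ , δ , e₂) = α + γ , β + δ , (begin
    u + u' + (α + γ) * L        ≡⟨ regroup u u' α γ L ⟩
    (u + α * L) + (u' + γ * L)  ≡⟨ cong₂ _+_ e₁ e₂ ⟩
    (v + β * L) + (v' + δ * L)  ≡⟨ regroup v v' β δ L ⟨
    v + v' + (β + δ) * L        ∎)
    where
    open ≡-Reasoning
    regroup : ∀ u u' α γ L → u + u' + (α + γ) * L ≡ (u + α * L) + (u' + γ * L)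
    regroup = solve-∀

  mod-cancelˡ : ∀ {w w' u v} → w ≡ w' mod L → w + u ≡ w' + v mod L → u ≡ v mod L
  mod-cancelˡ {w} {w'} {u} {v} (γ , δ , e₂) (α , β , e₁) = α + δ , β + γ ,
    +-cancelˡ-≡ (w + γ * L) _ _ (begin
      (w + γ * L) + (u + (α + δ) * L)  ≡⟨ regroupₗ w γ u α δ L ⟩
      ((w + u) + α * L) + (γ + δ) * L  ≡⟨ cong (_+ (γ + δ) * L) e₁ ⟩
      ((w' + v) + β * L) + (γ + δ) * L ≡⟨ regroupᵣ w' δ v β γ L ⟩
      (w' + δ * L) + (v + (β + γ) * L) ≡⟨ cong (_+ (v + (β + γ) * L)) e₂ ⟨
      (w + γ * L) + (v + (β + γ) * L)  ∎)
    where
    open ≡-Reasoning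
    regroupₗ : ∀ w γ u α δ L → (w + γ * L) + (u + (α + δ) * L) ≡ ((w + u) + α * L) + (γ + δ) * L
    regroupₗ = solve-∀
    regroupᵣ : ∀ w' δ v β γ L → ((w' + v) + β * L) + (γ + δ) * L ≡ (w' + δ * L) + (v + (β + γ) * L)
    regroupᵣ = solve-∀

module _ {L : ℕ} {{_ : NonZero L}} where

  %-≡⇒mod : ∀ {u v} → u % L ≡ v % L → u ≡ v mod L
  %-≡⇒mod {u} {v} eq = v / L , u / L , (begin
    u + v / L * L                 ≡⟨ cong (_+ v / L * L) (m≡m%n+[m/n]*n u L) ⟩
    u % L + u / L * L + v / L * L ≡⟨ cong (λ r → r + u / L * L + v / L * L) eq ⟩
    v % L + u / L * L + v / L * L ≡⟨ swap (v % L) (u / L * L) (v / L * L) ⟩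
    v % L + v / L * L + u / L * L ≡⟨ cong (_+ u / L * L) (m≡m%n+[m/n]*n v L) ⟨
    v + u / L * L                 ∎)
    where
    open ≡-Reasoning
    swap : ∀ a b c → a + b + c ≡ a + c + b
    swap = solve-∀

  mod⇒%-≡ : ∀ {u v} → u ≡ v mod L → u % L ≡ v % L
  mod⇒%-≡ {u} {v} (α , β , eq) = begin
    u % L           ≡⟨ [m+kn]%n≡m%n u α L ⟨
    (u + α * L) % L ≡⟨ cong (_% L) eq ⟩
    (v + β * L) % L ≡⟨ [m+kn]%n≡m%n v β L ⟩
    v % L           ∎
    where open ≡-Reasoning

  mod⇒≡ : ∀ {u v} → u < L → v < L → u ≡ v mod L → u ≡ v
  mod⇒≡ u<L v<L u≡v = trans (sym (m<n⇒m%n≡m u<L)) (trans (mod⇒%-≡ u≡v) (m<n⇒m%n≡m v<L))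

module _ (L : ℕ) {{_ : NonZero L}} where

  FibPairCongruent : ℕ → ℕ → Set
  FibPairCongruent P n = fib n ≡ fib (n + P) mod L × fib (suc n) ≡ fib (suc n + P) mod L

  fibPair-suc : ∀ {P n} → FibPairCongruent P n → FibPairCongruent P (suc n)
  fibPair-suc (c₀ , c₁) = c₁ , mod-+ c₁ c₀

  fibPair-pred : ∀ {P n} → FibPairCongruent P (suc n) → FibPairCongruent P n
  fibPair-pred (c₁ , c₂) = mod-cancelˡ c₁ c₂ , c₁

  fibPair-all : ∀ {P} m → FibPairCongruent P m → ∀ n → FibPairCongruent P n
  fibPair-all {P} m cₘ n = up n (down m cₘ)
    where
    down : ∀ m → FibPairCongruent P m → FibPairCongruent P 0
    down zero    pair = pair
    down (suc m) pair = down m (fibPair-pred {P} {m} pair)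
    up : ∀ n → FibPairCongruent P 0 → FibPairCongruent P n
    up zero    pair = pair
    up (suc n) pair = fibPair-suc {P} {n} (up n pair)

  -- the pair (fib n, fib (1 + n)) mod L takes at most L * L values, and the recurrence can be run backwards
  fib-periodic : ∃ λ P → 1 ≤ P × (∀ n → fib n ≡ fib (n + P) mod L)
  fib-periodic = period (Finₚ.pigeonhole (n<1+n (L * L)) residues)
    where
    residue : ℕ → Fin L
    residue m = Fin.fromℕ< (m%n<n m L)

    residue-≡⇒mod : ∀ {m m'} → residue m ≡ residue m' → m ≡ m' mod L
    residue-≡⇒mod {m} {m'} eq = %-≡⇒mod (begin
      m % L                           ≡⟨ Finₚ.toℕ-fromℕ< (m%n<n m L) ⟨
      toℕ (residue m)                 ≡⟨ cong toℕ eq ⟩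
      toℕ (residue m')                ≡⟨ Finₚ.toℕ-fromℕ< (m%n<n m' L) ⟩
      m' % L                          ∎)
      where open ≡-Reasoning

    residues : Fin (suc (L * L)) → Fin (L * L)
    residues k = combine (residue (fib (toℕ k))) (residue (fib (suc (toℕ k))))

    period : (∃₂ λ i j → i Fin.< j × residues i ≡ residues j) →
             ∃ λ P → 1 ≤ P × (∀ n → fib n ≡ fib (n + P) mod L)
    period (i , j , i<j , eq) = P , m<n⇒0<n∸m i<j , λ n → proj₁ (fibPair-all (toℕ i) congruent-at-i n)
      where
      P = toℕ j ∸ toℕ i
      congruent-at-i : FibPairCongruent P (toℕ i)
      congruent-at-i with eq₀ , eq₁ ← Finₚ.combine-injective _ _ _ _ eq
        rewrite m+[n∸m]≡n (<⇒≤ i<j) = residue-≡⇒mod eq₀ , residue-≡⇒mod eq₁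

-- fib (2 + i) for i < N are distinct residues below L; adding a multiple of the period
-- to the index keeps the residue and makes the value at least L.
incongruent-fib-family : ∀ L {{_ : NonZero L}} N → fib (2 + N) < L →
  ∃ λ (g : Fin N → ℕ) → (∀ i → L ≤ fib (2 + g i)) × (∀ i j → fib (2 + g i) ≡ fib (2 + g j) mod L → i ≡ j)
incongruent-fib-family L N fib[2+N]<L with P , 1≤P , periodic ← fib-periodic L = g , long , injective
  where
  g : Fin N → ℕ
  g i = toℕ i + L * P

  periodic-* : ∀ k n → fib n ≡ fib (n + k * P) mod L
  periodic-* zero    n = subst (λ m → fib n ≡ fib m mod L) (sym (+-identityʳ n)) mod-refl
  periodic-* (suc k) n = mod-trans (periodic-* k n)
    (subst (λ m → fib (n + k * P) ≡ fib m mod L) (reassoc n k P) (periodic (n + k * P)))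
    where
    reassoc : ∀ n k P → n + k * P + P ≡ n + (P + k * P)
    reassoc = solve-∀

  long : ∀ i → L ≤ fib (2 + g i)
  long i = begin
    L             ≡⟨ *-identityʳ L ⟨
    L * 1         ≤⟨ *-monoʳ-≤ L 1≤P ⟩
    L * P         ≤⟨ m≤n+m (L * P) (toℕ i) ⟩
    g i           <⟨ n<fib[2+n] (g i) ⟩
    fib (2 + g i) ∎
    where open ≤-Reasoning

  small : ∀ i → fib (2 + toℕ i) < L
  small i = <-trans (fib-strictMono (Finₚ.toℕ<n i)) fib[2+N]<L

  injective : ∀ i j → fib (2 + g i) ≡ fib (2 + g j) mod L → i ≡ j
  injective i j eq = Finₚ.toℕ-injective (fib-injective (mod⇒≡ (small i) (small j)
    (mod-trans (periodic-* L (2 + toℕ i)) (mod-trans eq (mod-sym (periodic-* L (2 + toℕ j)))))))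

BlockDetermined : {A B : Set} → ℕ → (ℕ → B) → (ℕ → A) → Set
BlockDetermined L Y x = ∀ q q' r → r < L → Y q ≡ Y q' → x (q * L + r) ≡ x (q' * L + r)

module _ {B : Set} {D : ℕ} {τ : Morphism B} (uniform : Uniform D τ) where

  length-applyM : ∀ w → length (applyM τ w) ≡ length w * D
  length-applyM []      = refl
  length-applyM (t ∷ w) = trans (length-++ (τ t)) (cong₂ _+_ (uniform t) (length-applyM w))

  length-iterM : ∀ k t → length (iterM τ k t) ≡ D ^ k
  length-iterM zero    t = refl
  length-iterM (suc k) t =
    trans (length-applyM (iterM τ k t)) (trans (cong (_* D) (length-iterM k t)) (*-comm (D ^ k) D))

  applyM-block : ∀ w (y z : ℕ → B) → IsPrefix w y → IsPrefix (applyM τ w) z →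
                 ∀ {q} → q < length w → IsPrefix (τ (y q)) (λ j → z (q * D + j))
  applyM-block (t ∷ w) y z y-pre z-pre {zero} _ =
    subst (λ u → IsPrefix (τ u) z) (sym (prefix-head y y-pre)) (prefix-++ˡ (τ t) z z-pre)
  applyM-block (t ∷ w) y z y-pre z-pre {suc q} (s≤s q<n) =
    prefix-resp (τ (y (suc q))) (λ j → cong z (reindex j))
      (applyM-block w (λ i → y (suc i)) (λ i → z (length (τ t) + i))
        (prefix-tail y y-pre) (prefix-++ʳ (τ t) z z-pre) q<n)
    where
    reindex : ∀ j → length (τ t) + (q * D + j) ≡ suc q * D + j
    reindex j = trans (cong (_+ (q * D + j)) (uniform t)) (sym (+-assoc D (q * D) j))

  module _ (s : B) (y : ℕ → B) (fixed : IsIterativeFixedPoint τ s y) where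

    fixedPoint-block : ∀ q → IsPrefix (τ (y q)) (λ j → y (q * D + j))
    fixedPoint-block q with n , q<n ← proj₂ (proj₂ fixed) (suc q) =
      applyM-block (iterM τ n s) y y (proj₁ (proj₂ fixed) n) (proj₁ (proj₂ fixed) (suc n)) q<n

    applyM-prefix : ∀ {w} m → IsPrefix w (λ i → y (m + i)) → IsPrefix (applyM τ w) (λ i → y (m * D + i))
    applyM-prefix {[]}    m _     ()
    applyM-prefix {t ∷ w} m w-pre = prefix-++⁺ (τ t) (λ i → y (m * D + i))
      (subst (λ u → IsPrefix (τ u) (λ i → y (m * D + i))) y[m]≡t (fixedPoint-block m))
      (prefix-resp (applyM τ w) (λ i → cong y (reindex i))
        (applyM-prefix {w} (suc m)
          (prefix-resp w (λ i → cong y (+-suc m i)) (prefix-tail (λ i → y (m + i)) w-pre))))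
      where
      y[m]≡t : y m ≡ t
      y[m]≡t = trans (cong y (sym (+-identityʳ m))) (prefix-head (λ i → y (m + i)) w-pre)
      reindex : ∀ i → suc m * D + i ≡ m * D + (length (τ t) + i)
      reindex i = trans (cong (λ d → d + m * D + i) (sym (uniform t))) (+-reorder (length (τ t)) (m * D) i)
        where
        +-reorder : ∀ a b c → a + b + c ≡ b + (a + c)
        +-reorder = solve-∀

    iterM-block : ∀ k q → IsPrefix (iterM τ k (y q)) (λ r → y (q * D ^ k + r))
    iterM-block zero    q =
      prefix-cons (λ r → y (q * 1 + r)) (cong y (trans (+-identityʳ _) (*-identityʳ q))) (λ ())
    iterM-block (suc k) q =
      prefix-resp (iterM τ (suc k) (y q)) (λ r → cong y (reassoc q D (D ^ k) r))
        (applyM-prefix {iterM τ k (y q)} (q * D ^ k) (iterM-block k q))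
      where
      reassoc : ∀ q d dᵏ r → q * dᵏ * d + r ≡ q * (d * dᵏ) + r
      reassoc = solve-∀

automatic⇒blockDetermined : ∀ {A : Set} {D} {x : ℕ → A} → Automatic D x →
  Σ ℕ λ K → Σ (ℕ → Fin K) λ y → ∀ k → BlockDetermined (D ^ k) y x
automatic⇒blockDetermined {D = D} {x} (K , τ , s , y , f , uniform , fixed , x≡f∘y) = K , y , determined
  where
  determined : ∀ k → BlockDetermined (D ^ k) y x
  determined k q q' r r<Dᵏ yq≡yq' = begin
    x (q * D ^ k + r)      ≡⟨ x≡f∘y _ ⟩
    f (y (q * D ^ k + r))  ≡⟨ cong f (prefix-unique {u = iterM τ k (y q)} _ _ block block' r<n) ⟩
    f (y (q' * D ^ k + r)) ≡⟨ x≡f∘y _ ⟨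
    x (q' * D ^ k + r)     ∎
    where
    open ≡-Reasoning
    block : IsPrefix (iterM τ k (y q)) (λ r → y (q * D ^ k + r))
    block = iterM-block uniform s y fixed k q
    block' : IsPrefix (iterM τ k (y q)) (λ r → y (q' * D ^ k + r))
    block' = subst (λ u → IsPrefix (iterM τ k u) (λ r → y (q' * D ^ k + r))) (sym yq≡yq')
               (iterM-block uniform s y fixed k q')
    r<n : r < length (iterM τ k (y q))
    r<n = subst (r <_) (sym (length-iterM uniform k (y q))) r<Dᵏ

[m/n]*n+m%n≡m : ∀ m n {{_ : NonZero n}} → m / n * n + m % n ≡ m
[m/n]*n+m%n≡m m n = trans (+-comm (m / n * n) (m % n)) (sym (m≡m%n+[m/n]*n m n))

module _ {A B : Set} {s : A} (x : ℕ → A) {L : ℕ} {{_ : NonZero L}} {Y : ℕ → B}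
         (determined : BlockDetermined L Y x) where

  relocate : ∀ {m n} → Y (m / L) ≡ Y (n / L) → x (m / L * L + n % L) ≡ x n
  relocate {m} {n} eq =
    trans (determined (m / L) (n / L) (n % L) (m%n<n n L) eq) (cong x ([m/n]*n+m%n≡m n L))

  -- If the residues differed, shifting the occurrence of s at n into the block of the gap's
  -- endpoint (which carries the same Y-value) would place an s strictly inside the gap.
  gap-start-residue : ∀ p G {n} → GapAt s x p G → L ≤ G → x n ≡ s → Y (p / L) ≡ Y (n / L) → n % L ≤ p % L
  gap-start-residue p G {n} gap L≤G xn≡s eq =
    ≮⇒≥ λ p%<n% → gap-interior x p G gap (p<t p%<n%) t≤p+G (trans (relocate eq) xn≡s)
    where
    t = p / L * L + n % L
    p<t : p % L < n % L → p < t
    p<t p%<n% = subst (_< t) ([m/n]*n+m%n≡m p L) (+-monoʳ-< (p / L * L) p%<n%)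
    t≤p+G : t ≤ p + G
    t≤p+G = <⇒≤ (begin-strict
      t                 <⟨ +-monoʳ-< (p / L * L) (m%n<n n L) ⟩
      p / L * L + L     ≤⟨ +-monoˡ-≤ L (m/n*n≤m p L) ⟩
      p + L             ≤⟨ +-monoʳ-≤ p L≤G ⟩
      p + G             ∎)
      where open ≤-Reasoning

  gap-end-residue : ∀ p G {n} → GapAt s x p G → L ≤ G → x n ≡ s → Y ((p + suc G) / L) ≡ Y (n / L) →
                    (p + suc G) % L ≤ n % L
  gap-end-residue p G {n} gap L≤G xn≡s eq =
    ≮⇒≥ λ n%<e% → gap-interior x p G gap p<t (t≤p+G n%<e%) (trans (relocate eq) xn≡s)
    where
    e = p + suc G
    t = e / L * L + n % L
    t≤p+G : n % L < e % L → t ≤ p + G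
    t≤p+G n%<e% =
      s≤s⁻¹ (subst (t <_) (trans ([m/n]*n+m%n≡m e L) (+-suc p G)) (+-monoʳ-< (e / L * L) n%<e%))
    p<t : p < t
    p<t = <-≤-trans (+-cancelʳ-< L p (e / L * L) (begin-strict
      p + L             <⟨ n<1+n (p + L) ⟩
      suc p + L         ≤⟨ +-monoʳ-≤ (suc p) L≤G ⟩
      suc p + G         ≡⟨ +-suc p G ⟨
      e                 ≡⟨ [m/n]*n+m%n≡m e L ⟨
      e / L * L + e % L ≤⟨ +-monoʳ-≤ (e / L * L) (m%n≤n e L) ⟩
      e / L * L + L     ∎)) (m≤m+n (e / L * L) (n % L))
      where open ≤-Reasoning

  gap-lengths-congruent : ∀ p G p' G' → GapAt s x p G → GapAt s x p' G' → L ≤ G → L ≤ G' →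
    Y (p / L) ≡ Y (p' / L) → Y ((p + suc G) / L) ≡ Y ((p' + suc G') / L) → G ≡ G' mod L
  gap-lengths-congruent p G p' G' gap gap' L≤G L≤G' start-eq end-eq =
    mod-cancelˡ {w = 1} {w' = 1} {u = G} {v = G'} mod-refl
      (mod-cancelˡ {w = p} {w' = p'} (%-≡⇒mod start%≡) (%-≡⇒mod end%≡))
    where
    start%≡ : p % L ≡ p' % L
    start%≡ = ≤-antisym (gap-start-residue p' G' gap' L≤G' (gap-start x p G gap) (sym start-eq))
                        (gap-start-residue p G gap L≤G (gap-start x p' G' gap') start-eq)
    end%≡ : (p + suc G) % L ≡ (p' + suc G') % L
    end%≡ = ≤-antisym (gap-end-residue p G gap L≤G (proj₂ (proj₂ gap')) end-eq)
                      (gap-end-residue p' G' gap' L≤G' (proj₂ (proj₂ gap)) (sym end-eq))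

long-gaps-collide : ∀ {A : Set} {s : A} (x : ℕ → A) {K L} {{_ : NonZero L}} {Y : ℕ → Fin K} →
  BlockDetermined L Y x → (G : Fin (suc (K * K)) → ℕ) → (∀ i → L ≤ G i) →
  (∀ i → ∃ λ p → GapAt s x p (G i)) → ∃₂ λ i j → i ≢ j × G i ≡ G j mod L
long-gaps-collide x {K} {L} {Y} determined G long gaps =
  collide (Finₚ.pigeonhole (n<1+n (K * K)) boundary-blocks)
  where
  start : Fin (suc (K * K)) → ℕ
  start i = proj₁ (gaps i)

  boundary-blocks : Fin (suc (K * K)) → Fin (K * K)
  boundary-blocks i = combine (Y (start i / L)) (Y ((start i + suc (G i)) / L))

  collide : (∃₂ λ i j → i Fin.< j × boundary-blocks i ≡ boundary-blocks j) →
            ∃₂ λ i j → i ≢ j × G i ≡ G j mod L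
  collide (i , j , i<j , eq) with start-eq , end-eq ← Finₚ.combine-injective _ _ _ _ eq =
    i , j , Finₚ.<⇒≢ i<j ,
    gap-lengths-congruent x determined (start i) (G i) (start j) (G j)
      (proj₂ (gaps i)) (proj₂ (gaps j)) (long i) (long j) start-eq end-eq

n<m^n : ∀ {m} n → 1 < m → n < m ^ n
n<m^n zero    1<m = s≤s z≤n
n<m^n {m} (suc n) 1<m = ≤-<-trans (n<m^n n 1<m) (^-monoʳ-< m 1<m (n<1+n n))

fibonacci-gaps⇒¬automatic : ∀ {A : Set} {s : A} (x : ℕ → A) →
  (∀ n → ∃ λ p → GapAt s x p (fib (2 + n))) → ∀ D → 2 ≤ D → ¬ Automatic D x
fibonacci-gaps⇒¬automatic x gaps D 2≤D automatic =
  let K , y , determined = automatic⇒blockDetermined automatic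
      N = suc (K * K)
      k = fib (2 + N)
      instance
        L≢0 : NonZero (D ^ k)
        L≢0 = m^n≢0 D k {{>-nonZero (<-trans (s≤s z≤n) 2≤D)}}
      g , long , injective = incongruent-fib-family (D ^ k) N (n<m^n k 2≤D)
      i , j , i≢j , congruent =
        long-gaps-collide x (determined k) (λ i → fib (2 + g i)) long (λ i → gaps (g i))
  in i≢j (injective i j congruent)

σ₁-lengths : ∀ m → length (iterM σ₁ m b) ≡ fib (2 + m) × length (iterM σ₁ m ABC.c) ≡ fib (1 + m)
σ₁-lengths zero    = refl , refl
σ₁-lengths (suc m) with |b| , |c| ← σ₁-lengths m =
  trans (length-iterM-suc σ₁ m b) (cong₂ _+_ |b| (trans (+-identityʳ _) |c|)) ,
  trans (length-iterM-suc σ₁ m ABC.c) (trans (+-identityʳ _) |b|)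

σ₂-lengths : ∀ m → length (iterM σ₂ m ACD.c) ≡ fib (2 + m) × length (iterM σ₂ m d) ≡ fib (1 + m)
σ₂-lengths zero    = refl , refl
σ₂-lengths (suc m) with |c| , |d| ← σ₂-lengths m =
  trans (length-iterM-suc σ₂ m ACD.c) (cong₂ _+_ |c| (trans (+-identityʳ _) |d|)) ,
  trans (length-iterM-suc σ₂ m d) (trans (+-identityʳ _) |c|)

σ₁-avoids-a : ∀ {t} → t ≢ ABC.a → All (_≢ ABC.a) (σ₁ t)
σ₁-avoids-a {ABC.a} a≢a = ⊥-elim (a≢a refl)
σ₁-avoids-a {b}     _   = (λ ()) ∷ (λ ()) ∷ []
σ₁-avoids-a {ABC.c} _   = (λ ()) ∷ []

σ₂-avoids-a : ∀ {t} → t ≢ ACD.a → All (_≢ ACD.a) (σ₂ t)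
σ₂-avoids-a {ACD.a} a≢a = ⊥-elim (a≢a refl)
σ₂-avoids-a {ACD.c} _   = (λ ()) ∷ (λ ()) ∷ []
σ₂-avoids-a {d}     _   = (λ ()) ∷ []

σ₁-gaps : ∀ x → IsIterativeFixedPoint σ₁ ABC.a x → ∀ n → ∃ λ p → GapAt ABC.a x p (fib (2 + n))
σ₁-gaps x (_ , prefixes , _) n
  with p , gap ← gap-iterM σ₁ {ABC.a} {ABC.c} refl x prefixes (suc n)
                   (iterM-All σ₁ σ₁-avoids-a (suc n) (λ ())) =
  p , subst (GapAt ABC.a x p) (proj₂ (σ₁-lengths (suc n))) gap

σ₂-gaps : ∀ x → IsIterativeFixedPoint σ₂ ACD.a x → ∀ n → ∃ λ p → GapAt ACD.a x p (fib (2 + n))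
σ₂-gaps x (_ , prefixes , _) n
  with p , gap ← gap-iterM σ₂ {ACD.a} {ACD.c} refl x prefixes n
                   (iterM-All σ₂ σ₂-avoids-a n (λ ())) =
  p , subst (GapAt ACD.a x p) (proj₁ (σ₂-lengths n)) gap

mainTheorem8 : ((x : ℕ → ABC) → IsIterativeFixedPoint σ₁ ABC.a x →
    (d : ℕ) → 2 ≤ d → ¬ Automatic d x)
    × ((x : ℕ → ACD) → IsIterativeFixedPoint σ₂ ACD.a x →
    (d : ℕ) → 2 ≤ d → ¬ Automatic d x)
mainTheorem8 =
  (λ x fixed → fibonacci-gaps⇒¬automatic x (σ₁-gaps x fixed)) ,
  (λ x fixed → fibonacci-gaps⇒¬automatic x (σ₂-gaps x fixed))
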